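{- For every positive integer $i$ and every vertex $u\in L_i$, the set $N^+(u)$ is a clique.
   Context: Let $G$ be a graph with no induced claw ($K_{1,3}$) and no even hole (an induced cycle of even length at least $4$). Fix two adjacent vertices $u_0,u_1$ of $G$, let $B_0=N_G(u_0)\setminus\{u_1\}$, and let $G_0$ be the connected component of $G-B_0$ containing $u_0$. For $j\ge 0$, $L_j=\{u\in V(G_0): d_{G_0}(u,u_0)=j\}$. For $v\in L_i$, $N^+(v)=N_G(v)\cap L_{i+1}$. -}

module Defs where

open import Data.Nat using (ℕ; zero; suc; _+_; _*_; _<_)
open import Data.Fin using (Fin; toℕ)
open import Data.Bool using (Bool; true; false)
open import Data.Product using (_×_; ∃; ∃-syntax; Σ-syntax; _,_)
open import Data.Sum using (_⊎_)
open import Relation.Nullary using (¬_)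
open import Relation.Binary.PropositionalEquality using (_≡_; _≢_)
open import Function.Definitions using (Injective)
open import Function.Bundles using (_⇔_)

record Graph : Set where
  field
    n     : ℕ
    adj   : Fin n → Fin n → Bool
    sym   : ∀ x y → adj x y ≡ adj y x
    irrefl : ∀ x → adj x x ≡ false

module _ (G : Graph) where
  open Graph G

  Vertex : Set
  Vertex = Fin n

  Adj : Vertex → Vertex → Set
  Adj x y = adj x y ≡ true

  InducedClaw : Vertex → Vertex → Vertex → Vertex → Set
  InducedClaw c a b d =
    Adj c a × Adj c b × Adj c d ×
    a ≢ b × a ≢ d × b ≢ d ×
    ¬ Adj a b × ¬ Adj a d × ¬ Adj b d

  ClawFree : Set
  ClawFree = ∀ c a b d → ¬ InducedClaw c a b d

  CycConsec : {k : ℕ} → Fin k → Fin k → Set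
  CycConsec {k} i j =
    suc (toℕ i) ≡ toℕ j ⊎ suc (toℕ j) ≡ toℕ i ⊎
    (toℕ i ≡ 0 × suc (toℕ j) ≡ k) ⊎ (toℕ j ≡ 0 × suc (toℕ i) ≡ k)

  InducedCycle : (k : ℕ) → (Fin k → Vertex) → Set
  InducedCycle k v = Injective _≡_ _≡_ v × (∀ i j → Adj (v i) (v j) ⇔ CycConsec i j)

  EvenHoleFree : Set
  EvenHoleFree = ∀ m (v : Fin (2 * (2 + m)) → Vertex) → ¬ InducedCycle (2 * (2 + m)) v

  module Levels (u₀ u₁ : Vertex) where

    B₀ : Vertex → Set
    B₀ v = Adj u₀ v × v ≢ u₁

    Outside : Vertex → Set
    Outside v = ¬ B₀ v

    data Walk : Vertex → Vertex → ℕ → Set where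
      here : ∀ {x} → Outside x → Walk x x 0
      step : ∀ {x y z ℓ} → Outside x → Adj x y → Walk y z ℓ → Walk x z (suc ℓ)

    -- G₀ = component of G - B₀ containing u₀; d_{G₀}(u, u₀) = j
    -- (walks in G - B₀ starting at u₀ stay in G₀, so distances agree)
    L : ℕ → Vertex → Set
    L j u = Walk u₀ u j × (∀ ℓ → ℓ < j → ¬ Walk u₀ u ℓ)

    N⁺ : ℕ → Vertex → Vertex → Set
    N⁺ i v w = Adj v w × L (suc i) w

  IsClique : (Vertex → Set) → Set
  IsClique S = ∀ x y → S x → S y → x ≢ y → Adj x y

{-# OPTIONS --safe #-}
module Submission where

open import Defs
open import Data.Nat using (ℕ; suc; _<_)
open import Data.Nat.Properties using (n<1+n; <-trans)
open import Data.Bool using (true)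
open import Data.Bool.Properties using (_≟_)
open import Data.Product using (∃-syntax; _×_; _,_)
open import Relation.Nullary using (¬_; Dec)
open import Relation.Nullary.Decidable using (decidable-stable)
open import Relation.Binary.PropositionalEquality using (_≢_; refl; trans)

-- The parent w of u in L i is far from every vertex of L (2 + i), so if two
-- members of N⁺(u) were non-adjacent they would form a claw with w at u.

module _ (G : Graph) where

  adj? : ∀ x y → Dec (Adj G x y)
  adj? x y = Graph.adj G x y ≟ true

  Adj-sym : ∀ {x y} → Adj G x y → Adj G y x
  Adj-sym {x} {y} = trans (Graph.sym G y x)

  module _ (u₀ u₁ : Vertex G) where
    open Levels G u₀ u₁

    walk-target-outside : ∀ {x z ℓ} → Walk x z ℓ → Outside z
    walk-target-outside (here z-out)   = z-out
    walk-target-outside (step _ _ walk) = walk-target-outside walk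

    walk-snoc : ∀ {x y z ℓ} → Walk x y ℓ → Adj G y z → Outside z → Walk x z (suc ℓ)
    walk-snoc (here y-out)         yz z-out = step y-out yz (here z-out)
    walk-snoc (step x-out xx′ walk) yz z-out = step x-out xx′ (walk-snoc walk yz z-out)

    walk-last-step : ∀ {x z ℓ} → Walk x z (suc ℓ) → ∃[ y ] Walk x y ℓ × Adj G y z
    walk-last-step (step x-out xz (here _)) = _ , here x-out , xz
    walk-last-step (step x-out xx′ walk@(step _ _ _)) with walk-last-step walk
    ... | y , walk′ , yz = y , step x-out xx′ walk′ , yz

    walk-shorter-than-level-≢ : ∀ {w x ℓ j} → Walk u₀ w ℓ → L j x → ℓ < j → w ≢ x
    walk-shorter-than-level-≢ walk (_ , minimal) ℓ<j refl = minimal _ ℓ<j walk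

    walk-shorter-than-level-≁ : ∀ {w x ℓ j} → Walk u₀ w ℓ → L j x → suc ℓ < j → ¬ Adj G w x
    walk-shorter-than-level-≁ walk (x-walk , minimal) 1+ℓ<j wx =
      minimal _ 1+ℓ<j (walk-snoc walk wx (walk-target-outside x-walk))

lemma2p1 : (G : Graph) → ClawFree G → EvenHoleFree G →
    (u₀ u₁ : Vertex G) → Adj G u₀ u₁ →
    (i : ℕ) → (u : Vertex G) → Levels.L G u₀ u₁ (suc i) u →
    IsClique G (Levels.N⁺ G u₀ u₁ (suc i) u)
lemma2p1 G claw-free _ u₀ u₁ _ i u (u-walk , _) x y (ux , x∈L) (uy , y∈L) x≢y
  with walk-last-step G u₀ u₁ u-walk
... | w , w-walk , wu =
  decidable-stable (adj? G x y) λ x≁y →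
    claw-free u w x y
      (Adj-sym G wu , ux , uy , w≢ x∈L , w≢ y∈L , x≢y , w≁ x∈L , w≁ y∈L , x≁y)
  where
    open Levels G u₀ u₁

    w≢ : ∀ {z} → L (suc (suc i)) z → w ≢ z
    w≢ z∈L = walk-shorter-than-level-≢ G u₀ u₁ w-walk z∈L
               (<-trans (n<1+n i) (n<1+n (suc i)))

    w≁ : ∀ {z} → L (suc (suc i)) z → ¬ Adj G w z
    w≁ z∈L = walk-shorter-than-level-≁ G u₀ u₁ w-walk z∈L (n<1+n (suc i))
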